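{- Let $f(n)=0$ if the Sharing Nim position $(0,0,n)$ is a $\mathcal{P}$-position and $f(n)=1$ otherwise. Then the sequence $(f(n))_{n\ge 0}$ is not ultimately periodic; that is, there do not exist $n_0\ge 0$ and $p>0$ such that $f(n+p)=f(n)$ for all $n\ge n_0$.
   Context: Three-pile Sharing Nim: a position is a triple of nonnegative integers (pile sizes; order irrelevant). A move takes some positive number $k$ of tokens from one pile and adds them to another pile, provided that after the move the receiving pile does not have more tokens than the source pile; i.e. from $(a,b,c)$ with $a\le b\le c$ one may move to $(a+k,b-k,c)$ with $1\le k\le (b-a)/2$, to $(a+k,b,c-k)$ with $1\le k\le (c-a)/2$, or to $(a,b+k,c-k)$ with $1\le k\le (c-b)/2$. Normal play. A $\mathcal{P}$-position is one from which the player about to move has no winning strategy. -}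

module Defs where

open import Data.Nat using (ℕ; zero; suc; _+_; _≤_; _<_)
open import Data.Product using (_×_; _,_; ∃; Σ)
open import Relation.Nullary using (¬_)
open import Function.Bundles using (_⇔_)

-- A Sharing Nim position: three piles (stored as an ordered triple;
-- the move relation below is symmetric under permuting the piles, so
-- order is irrelevant).
Pos : Set
Pos = ℕ × ℕ × ℕ

-- A move: take k ≥ 1 tokens from a source pile (of size k + s before the
-- move, s after) and add them to a receiving pile (r before, r + k after),
-- provided the receiving pile does not exceed the source pile afterwards:
-- r + k ≤ s.
data Move : Pos → Pos → Set where
  m12 : ∀ {k s r c} → 1 ≤ k → r + k ≤ s → Move (k + s , r , c) (s , r + k , c)
  m13 : ∀ {k s b r} → 1 ≤ k → r + k ≤ s → Move (k + s , b , r) (s , b , r + k)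
  m21 : ∀ {k s r c} → 1 ≤ k → r + k ≤ s → Move (r , k + s , c) (r + k , s , c)
  m23 : ∀ {k s a r} → 1 ≤ k → r + k ≤ s → Move (a , k + s , r) (a , s , r + k)
  m31 : ∀ {k s r b} → 1 ≤ k → r + k ≤ s → Move (r , b , k + s) (r + k , b , s)
  m32 : ∀ {k s a r} → 1 ≤ k → r + k ≤ s → Move (a , r , k + s) (a , r + k , s)

-- Win p : the player about to move from p has a winning strategy
-- (normal play): there is a move to some q such that every reply from q
-- leads again to a position where the mover has a winning strategy.
-- (The game is finite: the sum of squares strictly decreases.)
data Win : Pos → Set where
  win : ∀ {p q} → Move p q → (∀ {r} → Move q r → Win r) → Win p

IsP : Pos → Set
IsP p = ¬ Win p

-- f n = 0 iff (0,0,n) is a P-position, f n = 1 otherwise.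
-- Hence f (n + p) ≡ f n is expressed as: (0,0,n+p) is P ⇔ (0,0,n) is P.
SameF : ℕ → ℕ → Set
SameF m n = IsP (0 , 0 , m) ⇔ IsP (0 , 0 , n)

UltimatelyPeriodic : Set
UltimatelyPeriodic =
  Σ ℕ λ n₀ → Σ ℕ λ p → (0 < p) × (∀ n → n₀ ≤ n → SameF (n + p) n)

-- The positions obtained by permuting (x, x, x + d) or (x + d, x + d, x),
-- where d = 0 or the 2-adic valuation of d is even, form the set 𝒫 of
-- P-positions: every move out of 𝒫 can be answered by a move back into 𝒫,
-- and every other sorted position has a move into 𝒫.  Hence (0, 0, n) is a
-- P-position iff n = 0 or ν₂(n) is even, so f(2n) ≠ f(n) for n > 0.  A period
-- p from n₀ on would give f(2n) = f(n) for n = (n₀ + 1) p.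
module Submission where

open import Data.Empty using (⊥-elim)
open import Data.List using (_∷_; [])
open import Data.Nat
open import Data.Nat.Induction using (<-wellFounded)
open import Data.Nat.Properties
open import Data.Nat.Tactic.RingSolver using (solve)
open import Data.Product using (_×_; _,_; ∃; Σ)
open import Data.Sum using (_⊎_; inj₁; inj₂)
open import Function.Bundles using (_⇔_; Equivalence)
open import Function.Construct.Composition using (_⇔-∘_)
open import Function.Construct.Identity using (⇔-id)
open import Induction.WellFounded using (Acc; acc)
open import Relation.Nullary using (¬_)
open import Relation.Binary.PropositionalEquality

open import Defs

mutual
  data EvenVal : ℕ → Set where
    odd    : ∀ m → EvenVal (suc (2 * m))
    double : ∀ {m} → OddVal m → EvenVal (2 * m)

  data OddVal : ℕ → Set where
    double : ∀ {m} → EvenVal m → OddVal (2 * m)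

mutual
  evenVal-pos : ∀ {n} → EvenVal n → 0 < n
  evenVal-pos (odd m)        = s≤s z≤n
  evenVal-pos (double {m} v) = <-≤-trans (oddVal-pos v) (m≤m+n m _)

  oddVal-pos : ∀ {n} → OddVal n → 0 < n
  oddVal-pos (double {m} v) = <-≤-trans (evenVal-pos v) (m≤m+n m _)

evenVal-double⁻¹ : ∀ {k} → EvenVal (2 * k) → OddVal k
evenVal-double⁻¹ {k} v = go v refl
  where
  go : ∀ {n} → EvenVal n → n ≡ 2 * k → OddVal k
  go (odd m)        eq = ⊥-elim (even≢odd k m (sym eq))
  go (double {m} w) eq = subst OddVal (*-cancelˡ-≡ m k 2 eq) w

halve : ∀ n → ∃ λ m → n ≡ 2 * m ⊎ n ≡ suc (2 * m)
halve zero = 0 , inj₁ refl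
halve (suc n) with halve n
... | m , inj₁ refl = m , inj₂ refl
... | m , inj₂ refl = suc m , inj₁ (solve (m ∷ []))

valuation-parity : ∀ n → n ≡ 0 ⊎ EvenVal n ⊎ OddVal n
valuation-parity n = go n (<-wellFounded n)
  where
  go : ∀ n → Acc _<_ n → n ≡ 0 ⊎ EvenVal n ⊎ OddVal n
  go n (acc smaller) with halve n
  ... | m     , inj₂ refl = inj₂ (inj₁ (odd m))
  ... | zero  , inj₁ refl = inj₁ refl
  ... | suc m , inj₁ refl with go (suc m) (smaller (m<m+n (suc m) (s≤s z≤n)))
  ...   | inj₁ ()
  ...   | inj₂ (inj₁ v) = inj₂ (inj₂ (double v))
  ...   | inj₂ (inj₂ v) = inj₂ (inj₁ (double v))

PGap : ℕ → Set
PGap d = d ≡ 0 ⊎ EvenVal d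

pgap-double⁻¹ : ∀ {k} → 0 < k → PGap (2 * k) → OddVal k
pgap-double⁻¹ {suc k} _ (inj₁ ())
pgap-double⁻¹         _ (inj₂ v) = evenVal-double⁻¹ v

pgap-or-oddVal : ∀ d → PGap d ⊎ OddVal d
pgap-or-oddVal d with valuation-parity d
... | inj₁ d≡0      = inj₁ (inj₁ d≡0)
... | inj₂ (inj₁ v) = inj₁ (inj₂ v)
... | inj₂ (inj₂ v) = inj₂ v

swap₁₂ : Pos → Pos
swap₁₂ (a , b , c) = b , a , c

swap₂₃ : Pos → Pos
swap₂₃ (a , b , c) = a , c , b

move-swap₁₂ : ∀ {p q} → Move p q → Move (swap₁₂ p) (swap₁₂ q)
move-swap₁₂ (m12 k≥1 fits) = m21 k≥1 fits
move-swap₁₂ (m13 k≥1 fits) = m23 k≥1 fits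
move-swap₁₂ (m21 k≥1 fits) = m12 k≥1 fits
move-swap₁₂ (m23 k≥1 fits) = m13 k≥1 fits
move-swap₁₂ (m31 k≥1 fits) = m32 k≥1 fits
move-swap₁₂ (m32 k≥1 fits) = m31 k≥1 fits

move-swap₂₃ : ∀ {p q} → Move p q → Move (swap₂₃ p) (swap₂₃ q)
move-swap₂₃ (m12 k≥1 fits) = m13 k≥1 fits
move-swap₂₃ (m13 k≥1 fits) = m12 k≥1 fits
move-swap₂₃ (m21 k≥1 fits) = m31 k≥1 fits
move-swap₂₃ (m23 k≥1 fits) = m32 k≥1 fits
move-swap₂₃ (m31 k≥1 fits) = m21 k≥1 fits
move-swap₂₃ (m32 k≥1 fits) = m23 k≥1 fits

¬transfer-upward : ∀ {k s r} → 1 ≤ k → r + k ≤ s → ¬ (k + s ≤ r)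
¬transfer-upward {k} {s} {r} k≥1 fits k+s≤r =
  <⇒≱ (m<n+m s k≥1) (≤-trans k+s≤r (≤-trans (m≤m+n r k) fits))

data 𝒫 : Pos → Set where
  pairBelow : ∀ {x y d} → PGap d → y ≡ x + d → 𝒫 (x , x , y)
  pairAbove : ∀ {x y d} → PGap d → x ≡ y + d → 𝒫 (x , x , y)
  perm₁₂    : ∀ {p} → 𝒫 p → 𝒫 (swap₁₂ p)
  perm₂₃    : ∀ {p} → 𝒫 p → 𝒫 (swap₂₃ p)

Reaches𝒫 : Pos → Set
Reaches𝒫 p = Σ Pos λ q → Move p q × 𝒫 q

reaches𝒫-swap₁₂ : ∀ {p} → Reaches𝒫 (swap₁₂ p) → Reaches𝒫 p
reaches𝒫-swap₁₂ (q , mv , q∈𝒫) = swap₁₂ q , move-swap₁₂ mv , perm₁₂ q∈𝒫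

reaches𝒫-swap₂₃ : ∀ {p} → Reaches𝒫 (swap₂₃ p) → Reaches𝒫 p
reaches𝒫-swap₂₃ (q , mv , q∈𝒫) = swap₂₃ q , move-swap₂₃ mv , perm₂₃ q∈𝒫

move₃₁ : ∀ {a b c} k s → 1 ≤ k → a + k ≤ s → c ≡ k + s → Move (a , b , c) (a + k , b , s)
move₃₁ k s k≥1 fits refl = m31 k≥1 fits

move₂₁ : ∀ {a b c} k s → 1 ≤ k → a + k ≤ s → b ≡ k + s → Move (a , b , c) (a + k , s , c)
move₂₁ k s k≥1 fits refl = m21 k≥1 fits

reaches𝒫-lowPair : ∀ a {h} → EvenVal h → Reaches𝒫 (a , a + 0 , a + 0 + 2 * h)
reaches𝒫-lowPair a {h} v =
  _ , move₃₁ h (a + h) (evenVal-pos v) ≤-refl (solve (a ∷ h ∷ []))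
    , perm₂₃ (pairAbove (inj₂ v) (solve (a ∷ h ∷ [])))

reaches𝒫-highPair : ∀ a {h} → EvenVal h → Reaches𝒫 (a , a + 2 * h , a + 2 * h + 0)
reaches𝒫-highPair a {h} v =
  _ , move₂₁ h (a + h) (evenVal-pos v) ≤-refl (solve (a ∷ h ∷ []))
    , pairBelow (inj₂ v) (solve (a ∷ h ∷ []))

reaches𝒫-lowerGap≤upperGap : ∀ a e D → 1 ≤ e → Reaches𝒫 (a , a + e , a + e + (e + D))
reaches𝒫-lowerGap≤upperGap a e D e≥1 with pgap-or-oddVal D
... | inj₁ g =
  _ , move₃₁ e (a + e + D) e≥1 (m≤m+n (a + e) D) (solve (a ∷ e ∷ D ∷ []))
    , pairBelow g refl
... | inj₂ (double {h} v) =
  _ , move₃₁ (e + h) (a + (e + h)) (≤-trans e≥1 (m≤m+n e h)) ≤-refl (solve (a ∷ e ∷ h ∷ []))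
    , perm₂₃ (pairAbove (inj₂ v) (sym (+-assoc a e h)))

reaches𝒫-upperGap≤lowerGap : ∀ a e D → 1 ≤ e → Reaches𝒫 (a , a + (e + D) , a + (e + D) + e)
reaches𝒫-upperGap≤lowerGap a e D e≥1 with pgap-or-oddVal D
... | inj₁ g =
  _ , move₃₁ e (a + (e + D)) e≥1 (+-monoʳ-≤ a (m≤m+n e D)) (+-comm (a + (e + D)) e)
    , perm₁₂ (perm₂₃ (pairAbove g (sym (+-assoc a e D))))
... | inj₂ (double {h} v) =
  _ , move₃₁ (e + h) (a + (e + h)) (≤-trans e≥1 (m≤m+n e h)) ≤-refl (solve (a ∷ e ∷ h ∷ []))
    , perm₂₃ (pairBelow (inj₂ v) (solve (a ∷ e ∷ h ∷ [])))

-- The hypotheses say exactly that this sorted position is not in 𝒫.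
reaches𝒫-sorted : ∀ a e₁ e₂ → (e₁ ≡ 0 → OddVal e₂) → (e₂ ≡ 0 → OddVal e₁) →
                  Reaches𝒫 (a , a + e₁ , a + e₁ + e₂)
reaches𝒫-sorted a e₁ e₂ odd₂ odd₁ with ≤-total e₁ e₂
... | inj₁ e₁≤e₂ with m≤n⇒∃[o]m+o≡n e₁≤e₂
...   | D , refl = lowerGapSmaller e₁ odd₂
  where
  lowerGapSmaller : ∀ e → (e ≡ 0 → OddVal (e + D)) → Reaches𝒫 (a , a + e , a + e + (e + D))
  lowerGapSmaller zero    odd-gap with odd-gap refl
  ... | double v = reaches𝒫-lowPair a v
  lowerGapSmaller (suc e) _ = reaches𝒫-lowerGap≤upperGap a (suc e) D (s≤s z≤n)
reaches𝒫-sorted a e₁ e₂ odd₂ odd₁ | inj₂ e₂≤e₁ with m≤n⇒∃[o]m+o≡n e₂≤e₁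
...   | D , refl = upperGapSmaller e₂ odd₁
  where
  upperGapSmaller : ∀ e → (e ≡ 0 → OddVal (e + D)) → Reaches𝒫 (a , a + (e + D) , a + (e + D) + e)
  upperGapSmaller zero    odd-gap with odd-gap refl
  ... | double v = reaches𝒫-highPair a v
  upperGapSmaller (suc e) _ = reaches𝒫-upperGap≤lowerGap a (suc e) D (s≤s z≤n)

pgap-halving : ∀ {r k d} → 1 ≤ k → PGap d → k + (r + k + 0) ≡ r + d → OddVal k
pgap-halving {r} {k} {d} k≥1 g eq = pgap-double⁻¹ k≥1 (subst PGap d≡2k g)
  where
  d≡2k : d ≡ 2 * k
  d≡2k = +-cancelˡ-≡ r d (2 * k) (trans (sym eq) (solve (r ∷ k ∷ [])))

absurd-zero : ∀ {k} {A : Set} → 1 ≤ k → k ≡ 0 → A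
absurd-zero (s≤s _) ()

pairBelow-reply : ∀ {x y d q} → PGap d → y ≡ x + d → Move (x , x , y) q → Reaches𝒫 q
pairBelow-reply g eq (m31 {k} {s} {r} k≥1 fits) with m≤n⇒∃[o]m+o≡n fits
... | t , refl = reaches𝒫-swap₁₂ (reaches𝒫-sorted r k t (absurd-zero k≥1)
                   (λ { refl → pgap-halving k≥1 g eq }))
pairBelow-reply g eq (m32 {k} {s} {a} k≥1 fits) with m≤n⇒∃[o]m+o≡n fits
... | t , refl = reaches𝒫-sorted a k t (absurd-zero k≥1)
                   (λ { refl → pgap-halving k≥1 g eq })
pairBelow-reply _ _ (m12 k≥1 fits) = ⊥-elim (¬transfer-upward k≥1 fits ≤-refl)
pairBelow-reply _ _ (m21 k≥1 fits) = ⊥-elim (¬transfer-upward k≥1 fits ≤-refl)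
pairBelow-reply {d = d} _ refl (m13 {k} {s} k≥1 fits) =
  ⊥-elim (¬transfer-upward k≥1 fits (m≤m+n (k + s) d))
pairBelow-reply {d = d} _ refl (m23 {k} {s} k≥1 fits) =
  ⊥-elim (¬transfer-upward k≥1 fits (m≤m+n (k + s) d))

pairAbove-sortedReply : ∀ r k t {d} → 1 ≤ k → PGap d → k + (r + k + t) ≡ r + d →
                        Reaches𝒫 (r + k , r + k + t , k + (r + k + t))
pairAbove-sortedReply r k t k≥1 g eq =
  subst (λ c → Reaches𝒫 (r + k , r + k + t , c)) (+-comm (r + k + t) k)
    (reaches𝒫-sorted (r + k) t k (λ { refl → pgap-halving k≥1 g eq }) (absurd-zero k≥1))

pairAbove-reply : ∀ {x y d q} → PGap d → x ≡ y + d → Move (x , x , y) q → Reaches𝒫 q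
pairAbove-reply g eq (m13 {k} {s} {r = r} k≥1 fits) with m≤n⇒∃[o]m+o≡n fits
... | t , refl = reaches𝒫-swap₂₃ (reaches𝒫-swap₁₂ (pairAbove-sortedReply r k t k≥1 g eq))
pairAbove-reply g eq (m23 {k} {s} {r = r} k≥1 fits) with m≤n⇒∃[o]m+o≡n fits
... | t , refl = reaches𝒫-swap₁₂ (reaches𝒫-swap₂₃ (reaches𝒫-swap₁₂ (pairAbove-sortedReply r k t k≥1 g eq)))
pairAbove-reply _ _ (m12 k≥1 fits) = ⊥-elim (¬transfer-upward k≥1 fits ≤-refl)
pairAbove-reply _ _ (m21 k≥1 fits) = ⊥-elim (¬transfer-upward k≥1 fits ≤-refl)
pairAbove-reply {d = d} _ refl (m31 {k} {s} k≥1 fits) =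
  ⊥-elim (¬transfer-upward k≥1 fits (m≤m+n (k + s) d))
pairAbove-reply {d = d} _ refl (m32 {k} {s} k≥1 fits) =
  ⊥-elim (¬transfer-upward k≥1 fits (m≤m+n (k + s) d))

𝒫-reply : ∀ {p q} → 𝒫 p → Move p q → Reaches𝒫 q
𝒫-reply (pairBelow g eq) mv = pairBelow-reply g eq mv
𝒫-reply (pairAbove g eq) mv = pairAbove-reply g eq mv
𝒫-reply (perm₁₂ p∈𝒫)     mv = reaches𝒫-swap₁₂ (𝒫-reply p∈𝒫 (move-swap₁₂ mv))
𝒫-reply (perm₂₃ p∈𝒫)     mv = reaches𝒫-swap₂₃ (𝒫-reply p∈𝒫 (move-swap₂₃ mv))

𝒫⇒IsP : ∀ {p} → 𝒫 p → IsP p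
𝒫⇒IsP p∈𝒫 (win mv replies) with 𝒫-reply p∈𝒫 mv
... | q , mv′ , q∈𝒫 = 𝒫⇒IsP q∈𝒫 (replies mv′)

potential : Pos → ℕ
potential (a , b , c) = a * a + b * b + c * c

-- Moving k tokens from a pile k + s onto a pile r, where s = r + k + t,
-- lowers the sum of squares by 2k(k + t).
potential-drop : ∀ {m n} k t → 1 ≤ k → n + 2 * k * (k + t) ≡ m → suc n ≤ m
potential-drop {n = n} (suc k) t _ refl = m<m+n n (s≤s z≤n)

move-decreases : ∀ {p q} → Move p q → potential q < potential p
move-decreases (m12 {k} {s} {r} {c} k≥1 fits) with m≤n⇒∃[o]m+o≡n fits
... | t , refl = potential-drop k t k≥1 (solve (k ∷ t ∷ r ∷ c ∷ []))
move-decreases (m13 {k} {s} {b} {r} k≥1 fits) with m≤n⇒∃[o]m+o≡n fits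
... | t , refl = potential-drop k t k≥1 (solve (k ∷ t ∷ b ∷ r ∷ []))
move-decreases (m21 {k} {s} {r} {c} k≥1 fits) with m≤n⇒∃[o]m+o≡n fits
... | t , refl = potential-drop k t k≥1 (solve (k ∷ t ∷ r ∷ c ∷ []))
move-decreases (m23 {k} {s} {a} {r} k≥1 fits) with m≤n⇒∃[o]m+o≡n fits
... | t , refl = potential-drop k t k≥1 (solve (k ∷ t ∷ a ∷ r ∷ []))
move-decreases (m31 {k} {s} {r} {b} k≥1 fits) with m≤n⇒∃[o]m+o≡n fits
... | t , refl = potential-drop k t k≥1 (solve (k ∷ t ∷ r ∷ b ∷ []))
move-decreases (m32 {k} {s} {a} {r} k≥1 fits) with m≤n⇒∃[o]m+o≡n fits
... | t , refl = potential-drop k t k≥1 (solve (k ∷ t ∷ a ∷ r ∷ []))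

𝒫-successors-win : ∀ {q r} → Acc _<_ (potential q) → 𝒫 q → Move q r → Win r
𝒫-successors-win (acc smaller) q∈𝒫 mv with 𝒫-reply q∈𝒫 mv
... | q′ , mv′ , q′∈𝒫 =
  win mv′ (𝒫-successors-win (smaller (<-trans (move-decreases mv′) (move-decreases mv))) q′∈𝒫)

reaches𝒫⇒Win : ∀ {p} → Reaches𝒫 p → Win p
reaches𝒫⇒Win (q , mv , q∈𝒫) = win mv (𝒫-successors-win (<-wellFounded (potential q)) q∈𝒫)

evenVal⇒IsP : ∀ {n} → EvenVal n → IsP (0 , 0 , n)
evenVal⇒IsP v = 𝒫⇒IsP (pairBelow (inj₂ v) refl)

oddVal⇒Win : ∀ {n} → OddVal n → Win (0 , 0 , n)
oddVal⇒Win v = reaches𝒫⇒Win (reaches𝒫-sorted 0 0 _ (λ _ → v) (λ n≡0 → subst OddVal n≡0 v))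

f-doubling : ∀ {n} → 0 < n → ¬ SameF (2 * n) n
f-doubling {n} n>0 same with valuation-parity n
... | inj₁ refl     = <-irrefl refl n>0
... | inj₂ (inj₁ v) = Equivalence.from same (evenVal⇒IsP v) (oddVal⇒Win (double v))
... | inj₂ (inj₂ v) = Equivalence.to same (evenVal⇒IsP (double v)) (oddVal⇒Win v)

periodic-multiples : ∀ {Q : ℕ → Set} {n₀ p} → (∀ n → n₀ ≤ n → Q (n + p) ⇔ Q n) →
                     ∀ j {n} → n₀ ≤ n → Q (j * p + n) ⇔ Q n
periodic-multiples periodic zero    _      = ⇔-id _
periodic-multiples {Q} {n₀} {p} periodic (suc j) {n} n₀≤n =
  periodic n n₀≤n ⇔-∘ subst (λ m → Q m ⇔ Q (n + p)) shift
                          (periodic-multiples periodic j (≤-trans n₀≤n (m≤m+n n p)))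
  where
  shift : j * p + (n + p) ≡ suc j * p + n
  shift = solve (j ∷ p ∷ n ∷ [])

mainTheorem9 : ¬ UltimatelyPeriodic
mainTheorem9 (n₀ , suc p , _ , periodic) = f-doubling (s≤s z≤n) (subst (λ m → SameF m n) n+n≡2n same)
  where
  n : ℕ
  n = suc n₀ * suc p
  same : SameF (n + n) n
  same = periodic-multiples periodic (suc n₀) (≤-trans (n≤1+n n₀) (m≤m*n (suc n₀) (suc p)))
  n+n≡2n : n + n ≡ 2 * n
  n+n≡2n = cong (n +_) (sym (+-identityʳ n))
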